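{- Let $m\ge3$ be an integer, $\mathbf{a}=(a_1,a_2,a_3,a_4)\in\mathbb{N}^4$ with $a_1\le a_2\le a_3\le a_4$, $A=a_1+a_2+a_3+a_4$, $a\in\mathbb{N}$, $b\in\mathbb{Z}$, and $N=\frac{m-2}{2}(a-b)+b$. Suppose the system $$a=a_1x_1^2+a_2x_2^2+a_3x_3^2+a_4x_4^2,\qquad b=a_1x_1+a_2x_2+a_3x_3+a_4x_4$$ has an integer solution $(x_1,x_2,x_3,x_4)\in\mathbb{Z}^4$. Then (i) $a\equiv b\pmod 2$, $Aa-b^2\ge0$, and $N=P_{m,\mathbf{a}}(x_1,x_2,x_3,x_4)$; (ii) if $b\ge\sqrt{A-a_1}\cdot\sqrt a$, then $N$ is represented by $P_{m,\mathbf{a}}$ over $\mathbb{N}_0$, i.e. $N=P_{m,\mathbf{a}}(\mathbf{y})$ for some $\mathbf{y}\in\mathbb{N}_0^4$.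
   Context: For an integer $x$, $P_m(x)=\frac{m-2}{2}(x^2-x)+x$, and $P_{m,\mathbf{a}}(x_1,\ldots,x_4)=\sum_{i=1}^4a_iP_m(x_i)$. $\mathbb{N}_0$ denotes the non-negative integers. -}

module Defs where

open import Data.Nat using (ℕ)
open import Data.Integer using (ℤ; +_; _+_; _-_; _*_; _/ℕ_)

-- Polygonal number P_m(x) = (m-2)/2 (x^2 - x) + x.  Since x^2 - x is always
-- even, the division by 2 below is exact (so the rounding convention of /ℕ
-- is irrelevant).
P : ℕ → ℤ → ℤ
P m x = ((+ m - + 2) * (x * x - x)) /ℕ 2 + x

Pma : ℕ → (a₁ a₂ a₃ a₄ : ℕ) → (x₁ x₂ x₃ x₄ : ℤ) → ℤ
Pma m a₁ a₂ a₃ a₄ x₁ x₂ x₃ x₄ =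
  + a₁ * P m x₁ + + a₂ * P m x₂ + + a₃ * P m x₃ + + a₄ * P m x₄

-- N = (m-2)/2 (a - b) + b.  Under the hypotheses a ≡ b (mod 2) (part (i)),
-- so the division by 2 is exact.
NN : ℕ → ℕ → ℤ → ℤ
NN m a b = ((+ m - + 2) * (+ a - b)) /ℕ 2 + b

-- With T(x) = x (x - 1) / 2 ∈ ℕ one has x² - x = 2 T(x), hence a - b = 2 Σ aᵢ T(xᵢ)
-- and P_m(x) = (m - 2) T(x) + x, which gives N = P_{m,a}(x).  A a - b² ≥ 0 is
-- Cauchy–Schwarz, via Lagrange's identity.  For (ii), if some xᵢ < 0 then
-- removing aᵢ xᵢ from b leaves b′ > b ≥ 0, while Cauchy–Schwarz on the other three
-- terms gives b′² ≤ (A - aᵢ) a ≤ (A - a₁) a ≤ b²; so every xᵢ ≥ 0.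
module Submission where

open import Defs
open import Data.Nat using (ℕ; _≤_)
open import Data.Integer using (ℤ; +_; _+_; _-_; _*_) renaming (_≤_ to _≤ℤ_)
open import Data.Integer.Divisibility using (_∣_)
open import Data.Product using (_×_; Σ-syntax)
open import Relation.Binary.PropositionalEquality using (_≡_)

open import Data.Nat using (zero; suc)
import Data.Nat as ℕ
import Data.Nat.Properties as ℕ
open import Data.Nat.DivMod using (m*n/n≡m)
open import Data.Nat.Divisibility using (n∣m*n) renaming (_∣_ to _∣ℕ_)
open import Data.Integer using (-_; 0ℤ; -[1+_]; _<_; _/ℕ_; ∣_∣; +≤+; +<+; _≤?_; positive; nonNegative)
import Data.Integer.Properties as ℤ
open import Data.Integer.Tactic.RingSolver using (solve-∀; solve)
import Data.Nat.Tactic.RingSolver as ℕ-Solver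
open import Data.List using ([]; _∷_)
open import Data.Product using (_,_)
open import Relation.Nullary using (yes; no; contradiction)
open import Relation.Binary.PropositionalEquality
  using (refl; sym; trans; cong; subst; subst₂; module ≡-Reasoning)

0≤+ : ∀ n → 0ℤ ≤ℤ + n
0≤+ n = +≤+ ℕ.z≤n

0≤i+j : ∀ {i j} → 0ℤ ≤ℤ i → 0ℤ ≤ℤ j → 0ℤ ≤ℤ i + j
0≤i+j = ℤ.+-mono-≤

0≤i*j : ∀ {i j} → 0ℤ ≤ℤ i → 0ℤ ≤ℤ j → 0ℤ ≤ℤ i * j
0≤i*j {+ m} {+ n} _ _ rewrite sym (ℤ.pos-* m n) = +≤+ ℕ.z≤n

0≤i*i : ∀ i → 0ℤ ≤ℤ i * i
0≤i*i (+ n)    = 0≤i*j {+ n} {+ n} (0≤+ n) (0≤+ n)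
0≤i*i -[1+ n ] = 0≤+ (suc n ℕ.* suc n)

triangle : ℕ → ℕ
triangle zero    = 0
triangle (suc n) = triangle n ℕ.+ suc n

triangle*2≡n*[1+n] : ∀ n → triangle n ℕ.* 2 ≡ n ℕ.* suc n
triangle*2≡n*[1+n] zero    = refl
triangle*2≡n*[1+n] (suc n) = begin
  (triangle n ℕ.+ suc n) ℕ.* 2       ≡⟨ ℕ.*-distribʳ-+ 2 (triangle n) (suc n) ⟩
  triangle n ℕ.* 2 ℕ.+ suc n ℕ.* 2   ≡⟨ cong (ℕ._+ suc n ℕ.* 2) (triangle*2≡n*[1+n] n) ⟩
  n ℕ.* suc n ℕ.+ suc n ℕ.* 2        ≡⟨ ℕ-Solver.solve (n ∷ []) ⟩
  suc n ℕ.* suc (suc n)               ∎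
  where open ≡-Reasoning

½pronic : ℤ → ℕ
½pronic (+ zero)  = 0
½pronic (+ suc n) = triangle n
½pronic -[1+ n ]  = triangle (suc n)

+n*+[1+n]≡+triangle*2 : ∀ n → + n * + suc n ≡ + triangle n * + 2
+n*+[1+n]≡+triangle*2 n = begin
  + n * + suc n         ≡⟨ ℤ.pos-* n (suc n) ⟨
  + (n ℕ.* suc n)       ≡⟨ cong +_ (triangle*2≡n*[1+n] n) ⟨
  + (triangle n ℕ.* 2)  ≡⟨ ℤ.pos-* (triangle n) 2 ⟩
  + triangle n * + 2    ∎
  where open ≡-Reasoning

pronic-succ : ∀ i → (+ 1 + i) * (+ 1 + i) - (+ 1 + i) ≡ i * (+ 1 + i)
pronic-succ = solve-∀

pronic-neg-succ : ∀ i → (- (+ 1 + i)) * (- (+ 1 + i)) - (- (+ 1 + i)) ≡ (+ 1 + i) * (+ 2 + i)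
pronic-neg-succ = solve-∀

x*x-x≡½pronic*2 : ∀ x → x * x - x ≡ + ½pronic x * + 2
x*x-x≡½pronic*2 (+ zero)  = refl
x*x-x≡½pronic*2 (+ suc n) = trans (pronic-succ (+ n)) (+n*+[1+n]≡+triangle*2 n)
x*x-x≡½pronic*2 -[1+ n ]  = trans (pronic-neg-succ (+ n)) (+n*+[1+n]≡+triangle*2 (suc n))

/ℕ2-exact : ∀ k {i j} → 0ℤ ≤ℤ i → j ≡ i * + 2 → (+ k * j) /ℕ 2 ≡ + k * i
/ℕ2-exact k {+ n} _ refl = begin
  (+ k * (+ n * + 2)) /ℕ 2   ≡⟨ cong (_/ℕ 2) (ℤ.*-assoc (+ k) (+ n) (+ 2)) ⟨
  (+ k * + n * + 2) /ℕ 2     ≡⟨ cong (λ i → (i * + 2) /ℕ 2) (ℤ.pos-* k n) ⟨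
  (+ (k ℕ.* n) * + 2) /ℕ 2   ≡⟨ cong (_/ℕ 2) (ℤ.pos-* (k ℕ.* n) 2) ⟨
  + (k ℕ.* n ℕ.* 2 ℕ./ 2)    ≡⟨ cong +_ (m*n/n≡m (k ℕ.* n) 2) ⟩
  + (k ℕ.* n)                ≡⟨ ℤ.pos-* k n ⟩
  + k * + n                  ∎
  where open ≡-Reasoning

P-≡ : ∀ k x → P (2 ℕ.+ k) x ≡ + k * + ½pronic x + x
P-≡ k x = cong (_+ x) (/ℕ2-exact k (0≤+ (½pronic x)) (x*x-x≡½pronic*2 x))

NN-≡ : ∀ k a b {S} → 0ℤ ≤ℤ S → + a - b ≡ S * + 2 → NN (2 ℕ.+ k) a b ≡ + k * S + b
NN-≡ k a b 0≤S a-b≡S*2 = cong (_+ b) (/ℕ2-exact k 0≤S a-b≡S*2)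

weighted-sum-cong : ∀ c₁ c₂ c₃ c₄ {x₁ x₂ x₃ x₄ y₁ y₂ y₃ y₄ : ℤ} →
  x₁ ≡ y₁ → x₂ ≡ y₂ → x₃ ≡ y₃ → x₄ ≡ y₄ →
  c₁ * x₁ + c₂ * x₂ + c₃ * x₃ + c₄ * x₄ ≡ c₁ * y₁ + c₂ * y₂ + c₃ * y₃ + c₄ * y₄
weighted-sum-cong _ _ _ _ refl refl refl refl = refl

Σcx²-Σcx≡Σc[x²-x] : ∀ c₁ c₂ c₃ c₄ x₁ x₂ x₃ x₄ →
  (c₁ * (x₁ * x₁) + c₂ * (x₂ * x₂) + c₃ * (x₃ * x₃) + c₄ * (x₄ * x₄))
    - (c₁ * x₁ + c₂ * x₂ + c₃ * x₃ + c₄ * x₄)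
  ≡ c₁ * (x₁ * x₁ - x₁) + c₂ * (x₂ * x₂ - x₂) + c₃ * (x₃ * x₃ - x₃) + c₄ * (x₄ * x₄ - x₄)
Σcx²-Σcx≡Σc[x²-x] = solve-∀

Σc[t*2]≡Σct*2 : ∀ c₁ c₂ c₃ c₄ t₁ t₂ t₃ t₄ →
  c₁ * (t₁ * + 2) + c₂ * (t₂ * + 2) + c₃ * (t₃ * + 2) + c₄ * (t₄ * + 2)
  ≡ (c₁ * t₁ + c₂ * t₂ + c₃ * t₃ + c₄ * t₄) * + 2
Σc[t*2]≡Σct*2 = solve-∀

k*Σct+Σcx≡Σc[k*t+x] : ∀ k c₁ c₂ c₃ c₄ t₁ t₂ t₃ t₄ x₁ x₂ x₃ x₄ →
  k * (c₁ * t₁ + c₂ * t₂ + c₃ * t₃ + c₄ * t₄) + (c₁ * x₁ + c₂ * x₂ + c₃ * x₃ + c₄ * x₄)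
  ≡ c₁ * (k * t₁ + x₁) + c₂ * (k * t₂ + x₂) + c₃ * (k * t₃ + x₃) + c₄ * (k * t₄ + x₄)
k*Σct+Σcx≡Σc[k*t+x] = solve-∀

Σ½pronic : (a₁ a₂ a₃ a₄ : ℕ) (x₁ x₂ x₃ x₄ : ℤ) → ℤ
Σ½pronic a₁ a₂ a₃ a₄ x₁ x₂ x₃ x₄ =
  + a₁ * + ½pronic x₁ + + a₂ * + ½pronic x₂ + + a₃ * + ½pronic x₃ + + a₄ * + ½pronic x₄

0≤Σ½pronic : ∀ a₁ a₂ a₃ a₄ x₁ x₂ x₃ x₄ → 0ℤ ≤ℤ Σ½pronic a₁ a₂ a₃ a₄ x₁ x₂ x₃ x₄
0≤Σ½pronic a₁ a₂ a₃ a₄ x₁ x₂ x₃ x₄ =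
  0≤i+j (0≤i+j (0≤i+j (term a₁ x₁) (term a₂ x₂)) (term a₃ x₃)) (term a₄ x₄)
  where
  term : ∀ c x → 0ℤ ≤ℤ + c * + ½pronic x
  term c x = 0≤i*j (0≤+ c) (0≤+ (½pronic x))

quadratic-linear-difference : ∀ a₁ a₂ a₃ a₄ x₁ x₂ x₃ x₄ →
  (+ a₁ * (x₁ * x₁) + + a₂ * (x₂ * x₂) + + a₃ * (x₃ * x₃) + + a₄ * (x₄ * x₄))
    - (+ a₁ * x₁ + + a₂ * x₂ + + a₃ * x₃ + + a₄ * x₄)
  ≡ Σ½pronic a₁ a₂ a₃ a₄ x₁ x₂ x₃ x₄ * + 2
quadratic-linear-difference a₁ a₂ a₃ a₄ x₁ x₂ x₃ x₄ =
  trans (Σcx²-Σcx≡Σc[x²-x] (+ a₁) (+ a₂) (+ a₃) (+ a₄) x₁ x₂ x₃ x₄)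
    (trans (weighted-sum-cong (+ a₁) (+ a₂) (+ a₃) (+ a₄)
             (x*x-x≡½pronic*2 x₁) (x*x-x≡½pronic*2 x₂) (x*x-x≡½pronic*2 x₃) (x*x-x≡½pronic*2 x₄))
      (Σc[t*2]≡Σct*2 (+ a₁) (+ a₂) (+ a₃) (+ a₄) _ _ _ _))

Pma-≡ : ∀ k a₁ a₂ a₃ a₄ x₁ x₂ x₃ x₄ →
  Pma (2 ℕ.+ k) a₁ a₂ a₃ a₄ x₁ x₂ x₃ x₄
  ≡ + k * Σ½pronic a₁ a₂ a₃ a₄ x₁ x₂ x₃ x₄ + (+ a₁ * x₁ + + a₂ * x₂ + + a₃ * x₃ + + a₄ * x₄)
Pma-≡ k a₁ a₂ a₃ a₄ x₁ x₂ x₃ x₄ =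
  trans (weighted-sum-cong (+ a₁) (+ a₂) (+ a₃) (+ a₄) (P-≡ k x₁) (P-≡ k x₂) (P-≡ k x₃) (P-≡ k x₄))
    (sym (k*Σct+Σcx≡Σc[k*t+x] (+ k) (+ a₁) (+ a₂) (+ a₃) (+ a₄) _ _ _ _ x₁ x₂ x₃ x₄))

lagrange-identity₃ : ∀ c₁ c₂ c₃ x₁ x₂ x₃ →
  (c₁ + c₂ + c₃) * (c₁ * (x₁ * x₁) + c₂ * (x₂ * x₂) + c₃ * (x₃ * x₃))
    - (c₁ * x₁ + c₂ * x₂ + c₃ * x₃) * (c₁ * x₁ + c₂ * x₂ + c₃ * x₃)
  ≡ c₁ * c₂ * ((x₁ - x₂) * (x₁ - x₂)) + c₁ * c₃ * ((x₁ - x₃) * (x₁ - x₃))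
    + c₂ * c₃ * ((x₂ - x₃) * (x₂ - x₃))
lagrange-identity₃ = solve-∀

lagrange-identity₄ : ∀ c₁ c₂ c₃ c₄ x₁ x₂ x₃ x₄ →
  (c₁ + c₂ + c₃ + c₄) * (c₁ * (x₁ * x₁) + c₂ * (x₂ * x₂) + c₃ * (x₃ * x₃) + c₄ * (x₄ * x₄))
    - (c₁ * x₁ + c₂ * x₂ + c₃ * x₃ + c₄ * x₄) * (c₁ * x₁ + c₂ * x₂ + c₃ * x₃ + c₄ * x₄)
  ≡ c₁ * c₂ * ((x₁ - x₂) * (x₁ - x₂)) + c₁ * c₃ * ((x₁ - x₃) * (x₁ - x₃))
    + c₁ * c₄ * ((x₁ - x₄) * (x₁ - x₄)) + c₂ * c₃ * ((x₂ - x₃) * (x₂ - x₃))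
    + c₂ * c₄ * ((x₂ - x₄) * (x₂ - x₄)) + c₃ * c₄ * ((x₃ - x₄) * (x₃ - x₄))
lagrange-identity₄ = solve-∀

0≤c*c′*[x-y]² : ∀ {c c′} → 0ℤ ≤ℤ c → 0ℤ ≤ℤ c′ → ∀ x y → 0ℤ ≤ℤ c * c′ * ((x - y) * (x - y))
0≤c*c′*[x-y]² 0≤c 0≤c′ x y = 0≤i*j (0≤i*j 0≤c 0≤c′) (0≤i*i (x - y))

cauchy-schwarz₃ : ∀ {c₁ c₂ c₃} → 0ℤ ≤ℤ c₁ → 0ℤ ≤ℤ c₂ → 0ℤ ≤ℤ c₃ → ∀ x₁ x₂ x₃ →
  (c₁ * x₁ + c₂ * x₂ + c₃ * x₃) * (c₁ * x₁ + c₂ * x₂ + c₃ * x₃)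
  ≤ℤ (c₁ + c₂ + c₃) * (c₁ * (x₁ * x₁) + c₂ * (x₂ * x₂) + c₃ * (x₃ * x₃))
cauchy-schwarz₃ {c₁} {c₂} {c₃} p₁ p₂ p₃ x₁ x₂ x₃ =
  ℤ.0≤i-j⇒j≤i (subst (0ℤ ≤ℤ_) (sym (lagrange-identity₃ c₁ c₂ c₃ x₁ x₂ x₃))
    (0≤i+j (0≤i+j (0≤c*c′*[x-y]² p₁ p₂ x₁ x₂) (0≤c*c′*[x-y]² p₁ p₃ x₁ x₃))
      (0≤c*c′*[x-y]² p₂ p₃ x₂ x₃)))

cauchy-schwarz₄ : ∀ {c₁ c₂ c₃ c₄} → 0ℤ ≤ℤ c₁ → 0ℤ ≤ℤ c₂ → 0ℤ ≤ℤ c₃ → 0ℤ ≤ℤ c₄ →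
  ∀ x₁ x₂ x₃ x₄ →
  (c₁ * x₁ + c₂ * x₂ + c₃ * x₃ + c₄ * x₄) * (c₁ * x₁ + c₂ * x₂ + c₃ * x₃ + c₄ * x₄)
  ≤ℤ (c₁ + c₂ + c₃ + c₄) * (c₁ * (x₁ * x₁) + c₂ * (x₂ * x₂) + c₃ * (x₃ * x₃) + c₄ * (x₄ * x₄))
cauchy-schwarz₄ {c₁} {c₂} {c₃} {c₄} p₁ p₂ p₃ p₄ x₁ x₂ x₃ x₄ =
  ℤ.0≤i-j⇒j≤i (subst (0ℤ ≤ℤ_) (sym (lagrange-identity₄ c₁ c₂ c₃ c₄ x₁ x₂ x₃ x₄))
    (0≤i+j (0≤i+j (0≤i+j (0≤i+j (0≤i+j
      (0≤c*c′*[x-y]² p₁ p₂ x₁ x₂) (0≤c*c′*[x-y]² p₁ p₃ x₁ x₃)) (0≤c*c′*[x-y]² p₁ p₄ x₁ x₄))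
      (0≤c*c′*[x-y]² p₂ p₃ x₂ x₃)) (0≤c*c′*[x-y]² p₂ p₄ x₂ x₄)) (0≤c*c′*[x-y]² p₃ p₄ x₃ x₄)))

0≤i<j⇒i*i<j*j : ∀ {i j} → 0ℤ ≤ℤ i → i < j → i * i < j * j
0≤i<j⇒i*i<j*j {i} {j} 0≤i i<j = begin-strict
  i * i  ≤⟨ ℤ.*-monoˡ-≤-nonNeg i {{nonNegative 0≤i}} (ℤ.<⇒≤ i<j) ⟩
  i * j  <⟨ ℤ.*-monoʳ-<-pos j {{positive (ℤ.≤-<-trans 0≤i i<j)}} i<j ⟩
  j * j  ∎
  where open ℤ.≤-Reasoning

nonneg-coordinate : ∀ {w x a a′ b b′ C} → 0ℤ < w → 0ℤ ≤ℤ b → 0ℤ ≤ℤ C →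
  a ≡ w * (x * x) + a′ → b ≡ w * x + b′ →
  b′ * b′ ≤ℤ C * a′ → C * a ≤ℤ b * b → 0ℤ ≤ℤ x
nonneg-coordinate {w} {x} {a} {a′} {b} {b′} {C} 0<w 0≤b 0≤C a≡ b≡ cs Ca≤b² with 0ℤ ≤? x
... | yes 0≤x = 0≤x
... | no  0≰x = contradiction b²<b² (ℤ.<-irrefl refl)
  where
  w*x<0 : w * x < 0ℤ
  w*x<0 = subst (w * x <_) (ℤ.*-zeroʳ w) (ℤ.*-monoˡ-<-pos w {{positive 0<w}} (ℤ.≰⇒> 0≰x))

  b<b′ : b < b′
  b<b′ = subst₂ _<_ (sym b≡) (ℤ.+-identityˡ b′) (ℤ.+-monoˡ-< b′ w*x<0)

  a′≤a : a′ ≤ℤ a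
  a′≤a = subst (a′ ≤ℤ_) (sym a≡)
    (ℤ.i≤j+i a′ (w * (x * x)) {{nonNegative (0≤i*j (ℤ.<⇒≤ 0<w) (0≤i*i x))}})

  b²<b² : b * b < b * b
  b²<b² = begin-strict
    b * b    <⟨ 0≤i<j⇒i*i<j*j 0≤b b<b′ ⟩
    b′ * b′  ≤⟨ cs ⟩
    C * a′   ≤⟨ ℤ.*-monoˡ-≤-nonNeg C {{nonNegative 0≤C}} a′≤a ⟩
    C * a    ≤⟨ Ca≤b² ⟩
    b * b    ∎
    where open ℤ.≤-Reasoning

nonneg-coordinate₄ : ∀ {a b} w c₁ c₂ c₃ x y₁ y₂ y₃ → 1 ≤ w → 0ℤ ≤ℤ b →
  a ≡ + w * (x * x) + (+ c₁ * (y₁ * y₁) + + c₂ * (y₂ * y₂) + + c₃ * (y₃ * y₃)) →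
  b ≡ + w * x + (+ c₁ * y₁ + + c₂ * y₂ + + c₃ * y₃) →
  + (c₁ ℕ.+ c₂ ℕ.+ c₃) * a ≤ℤ b * b → 0ℤ ≤ℤ x
nonneg-coordinate₄ w c₁ c₂ c₃ x y₁ y₂ y₃ 1≤w 0≤b a≡ b≡ =
  nonneg-coordinate (+<+ 1≤w) 0≤b (0≤+ (c₁ ℕ.+ c₂ ℕ.+ c₃)) a≡ b≡
    (cauchy-schwarz₃ (0≤+ c₁) (0≤+ c₂) (0≤+ c₃) y₁ y₂ y₃)

2∣i*2 : ∀ i → + 2 ∣ i * + 2
2∣i*2 i = subst (2 ∣ℕ_) (sym (ℤ.abs-* i (+ 2))) (n∣m*n ∣ i ∣)

+-pull₁ : ∀ p q r s → p + q + r + s ≡ p + (q + r + s)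
+-pull₁ = solve-∀

+-pull₂ : ∀ p q r s → p + q + r + s ≡ q + (p + r + s)
+-pull₂ = solve-∀

+-pull₃ : ∀ p q r s → p + q + r + s ≡ r + (p + q + s)
+-pull₃ = solve-∀

+-pull₄ : ∀ p q r s → p + q + r + s ≡ s + (p + q + r)
+-pull₄ = solve-∀

nonneg-solution : ∀ {a₁ a₂ a₃ a₄} → 1 ≤ a₁ → a₁ ≤ a₂ → a₂ ≤ a₃ → a₃ ≤ a₄ →
  ∀ {a b} x₁ x₂ x₃ x₄ →
  + a ≡ + a₁ * (x₁ * x₁) + + a₂ * (x₂ * x₂) + + a₃ * (x₃ * x₃) + + a₄ * (x₄ * x₄) →
  b ≡ + a₁ * x₁ + + a₂ * x₂ + + a₃ * x₃ + + a₄ * x₄ →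
  0ℤ ≤ℤ b → + ((a₂ ℕ.+ a₃ ℕ.+ a₄) ℕ.* a) ≤ℤ b * b →
  0ℤ ≤ℤ x₁ × 0ℤ ≤ℤ x₂ × 0ℤ ≤ℤ x₃ × 0ℤ ≤ℤ x₄
nonneg-solution {a₁} {a₂} {a₃} {a₄} 1≤a₁ a₁≤a₂ a₂≤a₃ a₃≤a₄ {a} {b} x₁ x₂ x₃ x₄ a≡ b≡ 0≤b Da≤b² =
    nonneg-coordinate₄ a₁ a₂ a₃ a₄ x₁ x₂ x₃ x₄ 1≤a₁ 0≤b
      (trans a≡ (+-pull₁ q₁ q₂ q₃ q₄)) (trans b≡ (+-pull₁ l₁ l₂ l₃ l₄)) (dominated ℕ.≤-refl)
  , nonneg-coordinate₄ a₂ a₁ a₃ a₄ x₂ x₁ x₃ x₄ 1≤a₂ 0≤b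
      (trans a≡ (+-pull₂ q₁ q₂ q₃ q₄)) (trans b≡ (+-pull₂ l₁ l₂ l₃ l₄))
      (dominated (ℕ.+-monoˡ-≤ a₄ (ℕ.+-monoˡ-≤ a₃ a₁≤a₂)))
  , nonneg-coordinate₄ a₃ a₁ a₂ a₄ x₃ x₁ x₂ x₄ 1≤a₃ 0≤b
      (trans a≡ (+-pull₃ q₁ q₂ q₃ q₄)) (trans b≡ (+-pull₃ l₁ l₂ l₃ l₄))
      (dominated (ℕ.+-monoˡ-≤ a₄ (ℕ.+-mono-≤ a₁≤a₂ a₂≤a₃)))
  , nonneg-coordinate₄ a₄ a₁ a₂ a₃ x₄ x₁ x₂ x₃ 1≤a₄ 0≤b
      (trans a≡ (+-pull₄ q₁ q₂ q₃ q₄)) (trans b≡ (+-pull₄ l₁ l₂ l₃ l₄))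
      (dominated (ℕ.+-mono-≤ (ℕ.+-mono-≤ a₁≤a₂ a₂≤a₃) a₃≤a₄))
  where
  dominated : ∀ {C} → C ≤ a₂ ℕ.+ a₃ ℕ.+ a₄ → + C * + a ≤ℤ b * b
  dominated {C} C≤D = subst (_≤ℤ b * b) (ℤ.pos-* C a) (ℤ.≤-trans (+≤+ (ℕ.*-monoˡ-≤ a C≤D)) Da≤b²)

  q₁ = + a₁ * (x₁ * x₁) ; q₂ = + a₂ * (x₂ * x₂) ; q₃ = + a₃ * (x₃ * x₃) ; q₄ = + a₄ * (x₄ * x₄)
  l₁ = + a₁ * x₁ ; l₂ = + a₂ * x₂ ; l₃ = + a₃ * x₃ ; l₄ = + a₄ * x₄

  1≤a₂ = ℕ.≤-trans 1≤a₁ a₁≤a₂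
  1≤a₃ = ℕ.≤-trans 1≤a₂ a₂≤a₃
  1≤a₄ = ℕ.≤-trans 1≤a₃ a₃≤a₄

Pma-∣x∣≡Pma-x : ∀ m a₁ a₂ a₃ a₄ {x₁ x₂ x₃ x₄} →
  0ℤ ≤ℤ x₁ × 0ℤ ≤ℤ x₂ × 0ℤ ≤ℤ x₃ × 0ℤ ≤ℤ x₄ →
  Pma m a₁ a₂ a₃ a₄ (+ ∣ x₁ ∣) (+ ∣ x₂ ∣) (+ ∣ x₃ ∣) (+ ∣ x₄ ∣) ≡ Pma m a₁ a₂ a₃ a₄ x₁ x₂ x₃ x₄
Pma-∣x∣≡Pma-x m a₁ a₂ a₃ a₄ (0≤x₁ , 0≤x₂ , 0≤x₃ , 0≤x₄) =
  weighted-sum-cong (+ a₁) (+ a₂) (+ a₃) (+ a₄)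
    (cong (P m) (ℤ.0≤i⇒+∣i∣≡i 0≤x₁)) (cong (P m) (ℤ.0≤i⇒+∣i∣≡i 0≤x₂))
    (cong (P m) (ℤ.0≤i⇒+∣i∣≡i 0≤x₃)) (cong (P m) (ℤ.0≤i⇒+∣i∣≡i 0≤x₄))

lemma3p1 : (m : ℕ) → 3 ≤ m →
    (a₁ a₂ a₃ a₄ : ℕ) → 1 ≤ a₁ → a₁ ≤ a₂ → a₂ ≤ a₃ → a₃ ≤ a₄ →
    (a : ℕ) → 1 ≤ a → (b : ℤ) →
    (x₁ x₂ x₃ x₄ : ℤ) →
    + a ≡ + a₁ * (x₁ * x₁) + + a₂ * (x₂ * x₂) + + a₃ * (x₃ * x₃) + + a₄ * (x₄ * x₄) →
    b ≡ + a₁ * x₁ + + a₂ * x₂ + + a₃ * x₃ + + a₄ * x₄ →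
    ((+ 2 ∣ (+ a - b))
      × (+ 0 ≤ℤ + (a₁ Data.Nat.+ a₂ Data.Nat.+ a₃ Data.Nat.+ a₄) * + a - b * b)
      × (NN m a b ≡ Pma m a₁ a₂ a₃ a₄ x₁ x₂ x₃ x₄))
    × ((+ 0 ≤ℤ b) → + ((a₂ Data.Nat.+ a₃ Data.Nat.+ a₄) Data.Nat.* a) ≤ℤ b * b →
        Σ[ y₁ ∈ ℕ ] Σ[ y₂ ∈ ℕ ] Σ[ y₃ ∈ ℕ ] Σ[ y₄ ∈ ℕ ]
          (NN m a b ≡ Pma m a₁ a₂ a₃ a₄ (+ y₁) (+ y₂) (+ y₃) (+ y₄)))
lemma3p1 m@(suc (suc k)) (ℕ.s≤s (ℕ.s≤s _)) a₁ a₂ a₃ a₄ 1≤a₁ a₁≤a₂ a₂≤a₃ a₃≤a₄ a _ b x₁ x₂ x₃ x₄ a≡ b≡ =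
  (subst (+ 2 ∣_) (sym a-b≡S*2) (2∣i*2 S) , 0≤Aa-b² , N≡Pma) , representation-over-ℕ
  where
  S : ℤ
  S = Σ½pronic a₁ a₂ a₃ a₄ x₁ x₂ x₃ x₄

  a-b≡S*2 : + a - b ≡ S * + 2
  a-b≡S*2 = subst₂ (λ p q → p - q ≡ S * + 2) (sym a≡) (sym b≡)
    (quadratic-linear-difference a₁ a₂ a₃ a₄ x₁ x₂ x₃ x₄)

  0≤Aa-b² : 0ℤ ≤ℤ + (a₁ ℕ.+ a₂ ℕ.+ a₃ ℕ.+ a₄) * + a - b * b
  0≤Aa-b² = ℤ.i≤j⇒0≤j-i (subst₂ (λ p q → q * q ≤ℤ + (a₁ ℕ.+ a₂ ℕ.+ a₃ ℕ.+ a₄) * p) (sym a≡) (sym b≡)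
    (cauchy-schwarz₄ (0≤+ a₁) (0≤+ a₂) (0≤+ a₃) (0≤+ a₄) x₁ x₂ x₃ x₄))

  N≡Pma : NN m a b ≡ Pma m a₁ a₂ a₃ a₄ x₁ x₂ x₃ x₄
  N≡Pma = begin
    NN m a b
      ≡⟨ NN-≡ k a b (0≤Σ½pronic a₁ a₂ a₃ a₄ x₁ x₂ x₃ x₄) a-b≡S*2 ⟩
    + k * S + b
      ≡⟨ cong (λ i → + k * S + i) b≡ ⟩
    + k * S + (+ a₁ * x₁ + + a₂ * x₂ + + a₃ * x₃ + + a₄ * x₄)
      ≡⟨ Pma-≡ k a₁ a₂ a₃ a₄ x₁ x₂ x₃ x₄ ⟨
    Pma m a₁ a₂ a₃ a₄ x₁ x₂ x₃ x₄
      ∎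
    where open ≡-Reasoning

  representation-over-ℕ : 0ℤ ≤ℤ b → + ((a₂ ℕ.+ a₃ ℕ.+ a₄) ℕ.* a) ≤ℤ b * b →
    Σ[ y₁ ∈ ℕ ] Σ[ y₂ ∈ ℕ ] Σ[ y₃ ∈ ℕ ] Σ[ y₄ ∈ ℕ ]
      (NN m a b ≡ Pma m a₁ a₂ a₃ a₄ (+ y₁) (+ y₂) (+ y₃) (+ y₄))
  representation-over-ℕ 0≤b Da≤b² = ∣ x₁ ∣ , ∣ x₂ ∣ , ∣ x₃ ∣ , ∣ x₄ ∣ ,
    trans N≡Pma (sym (Pma-∣x∣≡Pma-x m a₁ a₂ a₃ a₄
      (nonneg-solution 1≤a₁ a₁≤a₂ a₂≤a₃ a₃≤a₄ x₁ x₂ x₃ x₄ a≡ b≡ 0≤b Da≤b²)))
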